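{- Let $n_1,\ldots,n_m$ be positive integers and set $n_{m+1}=0$. Then $$n_1!\prod_{i=1}^m\frac{(n_i+n_{i+1})!}{(2n_i)!}\sum_{k=-n_1}^{n_1}(-1)^k\prod_{i=1}^m\binom{2n_i}{n_i+k}\in\mathbb{N}.$$
   Context: Binomial coefficients $\binom{a}{b}$ are $0$ when $b<0$ or $b>a$; $\mathbb{N}=\{0,1,2,\ldots\}$. -}

module Defs where

open import Data.Nat using (ℕ; zero; suc; _+_; _*_; _<?_)
open import Data.Nat.Combinatorics using (_C_)
open import Data.Integer using (ℤ; +_; -[1+_]; -_; ∣_∣; _^_; _-_) renaming (_+_ to _+ℤ_; _*_ to _*ℤ_)
open import Data.Fin using (Fin; fromℕ<)
open import Relation.Nullary using (yes; no)

-- Binomial coefficient with integer lower index: (a choose b) = 0 for b < 0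
-- (and, by the library's _C_, also 0 for b > a).
binomℤ : ℕ → ℤ → ℕ
binomℤ a (+ b)     = a C b
binomℤ a -[1+ _ ]  = 0

sign : ℤ → ℤ
sign k = (- (+ 1)) ^ ∣ k ∣

-- 1-based access to the tuple (n_1,…,n_m), with n_j = 0 for j = 0 or j > m
-- (in particular n_{m+1} = 0).
nth : {m : ℕ} → (Fin m → ℕ) → ℕ → ℕ
nth {m} n zero = 0
nth {m} n (suc j) with j <? m
... | yes j<m = n (fromℕ< j<m)
... | no  _   = 0

prodℕ : ℕ → (ℕ → ℕ) → ℕ
prodℕ zero    f = 1
prodℕ (suc m) f = prodℕ m f * f (suc m)

prodℤ : ℕ → (ℕ → ℤ) → ℤ
prodℤ zero    f = + 1
prodℤ (suc m) f = prodℤ m f *ℤ f (suc m)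

sumRange : ℕ → (ℕ → ℤ) → ℤ
sumRange zero    g = + 0
sumRange (suc l) g = sumRange l g +ℤ g l

sumSym : ℕ → (ℤ → ℤ) → ℤ
sumSym a g = sumRange (suc (a + a)) (λ j → g ((+ j) - (+ a)))

module Submission where

-- Induction on the number of entries, merging the last two.  Write B(x,k) = C(2x,x+k).
-- The central identity
--   (a+b)! B(a,k) B(b,k) = Σ_{j ≤ a} B(j,k) (2a)!(2b)! / ((2j)!(a-j)!(b-j)!)
-- is Vandermonde's convolution once the factorials are cleared.  Applied to the last two
-- entries (a,b) and multiplied by the factorial prefactor, it writes the expression for
-- (n₁,…,n_{m-2},a,b) as Σ_j C(c+a,a-j) C(b,j) times the expression for (n₁,…,n_{m-2},j),
-- where c = n_{m-2} (and n₀ = 0); these are natural numbers by induction.  For a single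
-- entry a ≤ R the expression is Σ_{|k| ≤ R} (-1)^k C(2a,a+k), which is 1 for a = 0 and
-- otherwise telescopes to 0 by Pascal's rule.

open import Algebra.Bundles using (CommutativeSemiring)
open import Data.Nat as ℕ using (ℕ; zero; suc; _<_; _≤_; s≤s; _!; _∸_)
import Data.Nat.Properties as ℕₚ
open import Level using (Level)
open import Relation.Binary.PropositionalEquality as ≡
  using (_≡_; _≢_; cong; cong₂; subst; subst₂; module ≡-Reasoning)
open import Relation.Nullary using (yes; no)

module Summation {c ℓ : Level} (R : CommutativeSemiring c ℓ) where

  open CommutativeSemiring R
  open import Relation.Binary.Reasoning.Setoid setoid
  open import Algebra.Properties.CommutativeSemigroup +-commutativeSemigroup using (interchange)

  ∑ : ℕ → (ℕ → Carrier) → Carrier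
  ∑ zero    f = 0#
  ∑ (suc n) f = ∑ n f + f n

  ∑-cong : ∀ n {f g} → (∀ i → i < n → f i ≈ g i) → ∑ n f ≈ ∑ n g
  ∑-cong zero    eq = refl
  ∑-cong (suc n) eq = +-cong (∑-cong n (λ i i<n → eq i (ℕₚ.m<n⇒m<1+n i<n))) (eq n ℕₚ.≤-refl)

  ∑-zero : ∀ n {f} → (∀ i → i < n → f i ≈ 0#) → ∑ n f ≈ 0#
  ∑-zero zero    eq = refl
  ∑-zero (suc n) eq = begin
    ∑ n _ + _ ≈⟨ +-cong (∑-zero n (λ i i<n → eq i (ℕₚ.m<n⇒m<1+n i<n))) (eq n ℕₚ.≤-refl) ⟩
    0# + 0#   ≈⟨ +-identityˡ 0# ⟩
    0#        ∎

  ∑-distribˡ : ∀ n x f → x * ∑ n f ≈ ∑ n (λ i → x * f i)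
  ∑-distribˡ zero    x f = zeroʳ x
  ∑-distribˡ (suc n) x f = trans (distribˡ x (∑ n f) (f n)) (+-congʳ (∑-distribˡ n x f))

  ∑-distrib-+ : ∀ n f g → ∑ n (λ i → f i + g i) ≈ ∑ n f + ∑ n g
  ∑-distrib-+ zero    f g = sym (+-identityˡ 0#)
  ∑-distrib-+ (suc n) f g = begin
    ∑ n (λ i → f i + g i) + (f n + g n) ≈⟨ +-congʳ (∑-distrib-+ n f g) ⟩
    (∑ n f + ∑ n g) + (f n + g n)       ≈⟨ interchange (∑ n f) (∑ n g) (f n) (g n) ⟩
    (∑ n f + f n) + (∑ n g + g n)       ∎

  ∑-comm : ∀ m n (h : ℕ → ℕ → Carrier) → ∑ m (λ i → ∑ n (h i)) ≈ ∑ n (λ j → ∑ m (λ i → h i j))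
  ∑-comm zero    n h = sym (∑-zero n (λ _ _ → refl))
  ∑-comm (suc m) n h = begin
    ∑ m (λ i → ∑ n (h i)) + ∑ n (h m)         ≈⟨ +-congʳ (∑-comm m n h) ⟩
    ∑ n (λ j → ∑ m (λ i → h i j)) + ∑ n (h m) ≈⟨ ∑-distrib-+ n _ (h m) ⟨
    ∑ n (λ j → ∑ m (λ i → h i j) + h m j)     ∎

  ∑-suc : ∀ n f → ∑ (suc n) f ≈ f 0 + ∑ n (λ i → f (suc i))
  ∑-suc zero    f = trans (+-identityˡ (f 0)) (sym (+-identityʳ (f 0)))
  ∑-suc (suc n) f = begin
    ∑ (suc n) f + f (suc n)                   ≈⟨ +-congʳ (∑-suc n f) ⟩
    (f 0 + ∑ n (λ i → f (suc i))) + f (suc n) ≈⟨ +-assoc (f 0) _ _ ⟩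
    f 0 + ∑ (suc n) (λ i → f (suc i))         ∎

  ∑-single : ∀ n i {f} → i < n → (∀ t → t ≢ i → f t ≈ 0#) → ∑ n f ≈ f i
  ∑-single (suc n) i {f} i<1+n others with i ℕₚ.≟ n
  ... | yes ≡.refl = begin
    ∑ i f + f i ≈⟨ +-congʳ (∑-zero i (λ t t<i → others t (λ { ≡.refl → ℕₚ.<-irrefl ≡.refl t<i }))) ⟩
    0# + f i    ≈⟨ +-identityˡ (f i) ⟩
    f i         ∎
  ... | no i≢n = begin
    ∑ n f + f n ≈⟨ +-cong (∑-single n i (ℕₚ.≤∧≢⇒< (ℕₚ.≤-pred i<1+n) i≢n) others) (others n (λ n≡i → i≢n (≡.sym n≡i))) ⟩
    f i + 0#    ≈⟨ +-identityʳ (f i) ⟩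
    f i         ∎

  ∑-+ : ∀ m n f → ∑ (m ℕ.+ n) f ≈ ∑ m f + ∑ n (λ i → f (m ℕ.+ i))
  ∑-+ m zero    f = begin
    ∑ (m ℕ.+ 0) f ≡⟨ cong (λ k → ∑ k f) (ℕₚ.+-identityʳ m) ⟩
    ∑ m f         ≈⟨ +-identityʳ (∑ m f) ⟨
    ∑ m f + 0#    ∎
  ∑-+ m (suc n) f = begin
    ∑ (m ℕ.+ suc n) f                               ≡⟨ cong (λ k → ∑ k f) (ℕₚ.+-suc m n) ⟩
    ∑ (m ℕ.+ n) f + f (m ℕ.+ n)                     ≈⟨ +-congʳ (∑-+ m n f) ⟩
    (∑ m f + ∑ n (λ i → f (m ℕ.+ i))) + f (m ℕ.+ n) ≈⟨ +-assoc (∑ m f) _ _ ⟩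
    ∑ m f + ∑ (suc n) (λ i → f (m ℕ.+ i))           ∎

open import Data.Empty using (⊥-elim)
open import Data.Fin using (Fin)
open import Data.Integer using (ℤ; +_; -[1+_]; ∣_∣; -_; _-_; _⊖_; _^_) renaming (_+_ to _+ℤ_; _*_ to _*ℤ_)
import Data.Integer.Properties as ℤₚ
import Data.Integer.Tactic.RingSolver as ℤ-Solver
open import Data.Nat using (_+_; _*_)
open import Data.Nat.Combinatorics
  using (_C_; _P_; nCk≡n!/k![n-k]!; k>n⇒nCk≡0; nCk≡nC[n∸k]; nCk+nC[k+1]≡[n+1]C[k+1]; k![n∸k]!∣n!;
         nPk≡n!/[n∸k]!; k>n⇒nPk≡0; [n∸k]!k!∣n!)
open import Data.Nat.DivMod using (m/n*n≡m)
open import Data.Nat.Divisibility using (∣-trans; m∣m*n)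
open import Data.Nat.Tactic.RingSolver using (solve-∀)
open import Data.Product using (∃-syntax; _,_; map₂)
open ≡ using (refl; sym; trans)

open import Defs

module ℕ∑ = Summation ℕₚ.+-*-commutativeSemiring
module ℤ∑ = Summation ℤₚ.+-*-commutativeSemiring
open ℕ∑ using (∑)

nCk*[k!*[n∸k]!]≡n! : ∀ {n k} → k ≤ n → (n C k) * (k ! * (n ∸ k) !) ≡ n !
nCk*[k!*[n∸k]!]≡n! {n} {k} k≤n = trans (cong (_* (k ! * (n ∸ k) !)) (nCk≡n!/k![n-k]! k≤n)) (m/n*n≡m (k![n∸k]!∣n! k≤n))
  where instance _ = k ℕₚ.!* (n ∸ k) !≢0

nPk*[n∸k]!≡n! : ∀ {n k} → k ≤ n → (n P k) * (n ∸ k) ! ≡ n !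
nPk*[n∸k]!≡n! {n} {k} k≤n = trans (cong (_* (n ∸ k) !) (nPk≡n!/[n∸k]! k≤n)) (m/n*n≡m (∣-trans (m∣m*n (k !)) ([n∸k]!k!∣n! k≤n)))
  where instance _ = (n ∸ k) ℕₚ.!≢0

C-factorials : ∀ {n} r s → r + s ≡ n → (n C r) * (r ! * s !) ≡ n !
C-factorials r s refl = subst (λ t → ((r + s) C r) * (r ! * t !) ≡ (r + s) !) (ℕₚ.m+n∸m≡n r s) (nCk*[k!*[n∸k]!]≡n! (ℕₚ.m≤m+n r s))

P-factorial : ∀ {n} r s → r + s ≡ n → (n P r) * s ! ≡ n !
P-factorial r s refl = subst (λ t → ((r + s) P r) * t ! ≡ (r + s) !) (ℕₚ.m+n∸m≡n r s) (nPk*[n∸k]!≡n! (ℕₚ.m≤m+n r s))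

C-sym : ∀ {n} r s → r + s ≡ n → n C r ≡ n C s
C-sym r s refl = trans (nCk≡nC[n∸k] (ℕₚ.m≤m+n r s)) (cong ((r + s) C_) (ℕₚ.m+n∸m≡n r s))

vandermonde : ∀ x y z → ∑ (suc x) (λ u → (x C u) * (y C (z + u))) ≡ (x + y) C (x + z)
vandermonde zero    y z = trans (ℕₚ.+-identityʳ (y C (z + 0))) (cong (y C_) (ℕₚ.+-identityʳ z))
vandermonde (suc x) y z = begin
  ∑ (suc (suc x)) (λ u → (suc x C u) * (y C (z + u)))
    ≡⟨ ℕ∑.∑-suc (suc x) _ ⟩
  G 0 + ∑ (suc x) (λ u → (suc x C suc u) * (y C (z + suc u)))
    ≡⟨ cong (λ t → G 0 + t) (ℕ∑.∑-cong (suc x) (λ u _ → trans (cong (_* (y C (z + suc u))) (sym (nCk+nC[k+1]≡[n+1]C[k+1] x u)))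
                                                      (ℕₚ.*-distribʳ-+ (y C (z + suc u)) (x C u) _))) ⟩
  G 0 + ∑ (suc x) (λ u → (x C u) * (y C (z + suc u)) + G (suc u))
    ≡⟨ cong (λ t → G 0 + t) (ℕ∑.∑-distrib-+ (suc x) _ _) ⟩
  G 0 + (∑ (suc x) (λ u → (x C u) * (y C (z + suc u))) + ∑ (suc x) (λ u → G (suc u)))
    ≡⟨ x∙yz≈y∙xz (G 0) (∑ (suc x) (λ u → (x C u) * (y C (z + suc u)))) (∑ (suc x) (λ u → G (suc u))) ⟩
  ∑ (suc x) (λ u → (x C u) * (y C (z + suc u))) + (G 0 + ∑ (suc x) (λ u → G (suc u)))
    ≡⟨ cong₂ _+_ shifted unshifted ⟩
  (x + y) C suc (x + z) + (x + y) C (x + z)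
    ≡⟨ ℕₚ.+-comm ((x + y) C suc (x + z)) ((x + y) C (x + z)) ⟩
  (x + y) C (x + z) + (x + y) C suc (x + z)
    ≡⟨ nCk+nC[k+1]≡[n+1]C[k+1] (x + y) (x + z) ⟩
  (suc x + y) C (suc x + z)
    ∎
  where
  open ≡-Reasoning
  open import Algebra.Properties.CommutativeSemigroup ℕₚ.+-commutativeSemigroup using (x∙yz≈y∙xz)
  G : ℕ → ℕ
  G u = (x C u) * (y C (z + u))
  shifted : ∑ (suc x) (λ u → (x C u) * (y C (z + suc u))) ≡ (x + y) C suc (x + z)
  shifted = begin
    ∑ (suc x) (λ u → (x C u) * (y C (z + suc u))) ≡⟨ ℕ∑.∑-cong (suc x) (λ u _ → cong (λ t → (x C u) * (y C t)) (ℕₚ.+-suc z u)) ⟩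
    ∑ (suc x) (λ u → (x C u) * (y C (suc z + u))) ≡⟨ vandermonde x y (suc z) ⟩
    (x + y) C (x + suc z)                         ≡⟨ cong ((x + y) C_) (ℕₚ.+-suc x z) ⟩
    (x + y) C suc (x + z)                         ∎
  unshifted : G 0 + ∑ (suc x) (λ u → G (suc u)) ≡ (x + y) C (x + z)
  unshifted = begin
    G 0 + ∑ (suc x) (λ u → G (suc u)) ≡⟨ ℕ∑.∑-suc (suc x) G ⟨
    ∑ (suc x) G + G (suc x)           ≡⟨ cong (λ t → ∑ (suc x) G + t * (y C (z + suc x))) (k>n⇒nCk≡0 (ℕₚ.n<1+n x)) ⟩
    ∑ (suc x) G + 0                   ≡⟨ ℕₚ.+-identityʳ _ ⟩
    ∑ (suc x) G                       ≡⟨ vandermonde x y z ⟩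
    (x + y) C (x + z)                 ∎

factorials-via-binomials : ∀ c a b j → j ≤ a → j ≤ b →
                  (c + a) ! * b ! ≡ ((c + a) C (a ∸ j)) * (b C j) * (((a ∸ j) ! * (b ∸ j) !) * ((c + j) ! * j !))
factorials-via-binomials c a b j j≤a j≤b = begin
  (c + a) ! * b !
    ≡⟨ cong₂ _*_ (C-factorials (a ∸ j) (c + j) split-a) (C-factorials j (b ∸ j) (ℕₚ.m+[n∸m]≡n j≤b)) ⟨
  ((c + a) C (a ∸ j)) * ((a ∸ j) ! * (c + j) !) * ((b C j) * (j ! * (b ∸ j) !))
    ≡⟨ regroup ((c + a) C (a ∸ j)) ((a ∸ j) !) ((c + j) !) (b C j) (j !) ((b ∸ j) !) ⟩
  ((c + a) C (a ∸ j)) * (b C j) * (((a ∸ j) ! * (b ∸ j) !) * ((c + j) ! * j !))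
    ∎
  where
  open ≡-Reasoning
  split-a : (a ∸ j) + (c + j) ≡ c + a
  split-a = begin
    (a ∸ j) + (c + j) ≡⟨ ℕₚ.+-comm (a ∸ j) (c + j) ⟩
    (c + j) + (a ∸ j) ≡⟨ ℕₚ.+-assoc c j (a ∸ j) ⟩
    c + (j + (a ∸ j)) ≡⟨ cong (λ t → c + t) (ℕₚ.m+[n∸m]≡n j≤a) ⟩
    c + a             ∎
  regroup : ∀ x y z u v w → x * (y * z) * (u * (v * w)) ≡ x * u * ((y * w) * (z * v))
  regroup = solve-∀

kernel : ℕ → ℕ → ℕ → ℕ
kernel a b j = ((a + a) C (j + j)) * (((a ∸ j) + (a ∸ j)) P (a ∸ j)) * ((b + b) P (b + j))

kernel-factorial : ∀ {a b} j α β → j + α ≡ a → j + β ≡ b →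
                   kernel a b j * ((j + j) ! * (α ! * β !)) ≡ (a + a) ! * (b + b) !
kernel-factorial j α β refl refl rewrite ℕₚ.m+n∸m≡n j α = begin
  X * Y * Z * ((j + j) ! * (α ! * β !))           ≡⟨ regroup X Y Z ((j + j) !) (α !) (β !) ⟩
  (X * ((j + j) ! * (Y * α !))) * (Z * β !)      ≡⟨ cong (λ t → (X * ((j + j) ! * t)) * (Z * β !)) (P-factorial α α refl) ⟩
  (X * ((j + j) ! * (α + α) !)) * (Z * β !)      ≡⟨ cong₂ _*_ (C-factorials (j + j) (α + α) (double-+ j α))
                                                               (P-factorial ((j + β) + j) β (swap-+ j β)) ⟩
  ((j + α) + (j + α)) ! * ((j + β) + (j + β)) !  ∎
  where
  open ≡-Reasoning
  X = ((j + α) + (j + α)) C (j + j)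
  Y = (α + α) P α
  Z = ((j + β) + (j + β)) P ((j + β) + j)
  regroup : ∀ x y z w u v → x * y * z * (w * (u * v)) ≡ (x * (w * (y * u))) * (z * v)
  regroup = solve-∀
  double-+ : ∀ j α → (j + j) + (α + α) ≡ (j + α) + (j + α)
  double-+ = solve-∀
  swap-+ : ∀ j β → ((j + β) + j) + β ≡ (j + β) + (j + β)
  swap-+ = solve-∀

kernel-vanishes : ∀ a b j → b < j → kernel a b j ≡ 0
kernel-vanishes a b j b<j = trans (cong (X *_) (k>n⇒nPk≡0 (ℕₚ.+-monoʳ-< b b<j))) (ℕₚ.*-zeroʳ X)
  where X = ((a + a) C (j + j)) * (((a ∸ j) + (a ∸ j)) P (a ∸ j))

-- For k ≤ a, b write a = k + p and b = k + q.  After multiplication by D the summand for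
-- j = k + u becomes Z C(p,u) C(b+k,j+k), so the sum is Vandermonde's convolution.
module CentralIdentity (k p q : ℕ) where

  a b : ℕ
  a = k + p
  b = k + q

  D Z : ℕ
  D = ((a + k) ! * p !) * ((b + k) ! * q !)
  Z = (a + a) ! * (b + b) ! * (a + k) ! * q !

  summand : ℕ → ℕ
  summand j = ((j + j) C (j + k)) * kernel a b j

  convolution-summand : ℕ → ℕ
  convolution-summand u = (p C u) * ((b + k) C ((k + u) + k))

  cleared-summand-beyond : ∀ u → q < u → D * summand (k + u) ≡ Z * convolution-summand u
  cleared-summand-beyond u q<u = begin
    D * (((j + j) C (j + k)) * kernel a b j) ≡⟨ cong (λ t → D * (((j + j) C (j + k)) * t)) (kernel-vanishes a b j b<j) ⟩
    D * (((j + j) C (j + k)) * 0)           ≡⟨ cong (D *_) (ℕₚ.*-zeroʳ ((j + j) C (j + k))) ⟩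
    D * 0                                   ≡⟨ ℕₚ.*-zeroʳ D ⟩
    0                                       ≡⟨ ℕₚ.*-zeroʳ Z ⟨
    Z * 0                                   ≡⟨ cong (Z *_) (ℕₚ.*-zeroʳ (p C u)) ⟨
    Z * ((p C u) * 0)                       ≡⟨ cong (λ t → Z * ((p C u) * t)) (k>n⇒nCk≡0 (ℕₚ.+-monoˡ-< k b<j)) ⟨
    Z * ((p C u) * ((b + k) C (j + k)))     ∎
    where
    open ≡-Reasoning
    j : ℕ
    j = k + u
    b<j : b < j
    b<j = ℕₚ.+-monoʳ-< k q<u

  cleared-summand-within : ∀ u → u ≤ p → u ≤ q → D * summand (k + u) ≡ Z * convolution-summand u
  cleared-summand-within u u≤p u≤q = ℕₚ.*-cancelʳ-≡ _ _ E (trans lhs (sym rhs))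
    where
    open ≡-Reasoning
    j p′ q′ : ℕ
    j = k + u
    p′ = p ∸ u
    q′ = q ∸ u
    E : ℕ
    E = ((j + k) ! * u !) * (p′ ! * q′ !)
    instance
      _ = ℕₚ.m*n≢0 ((j + k) ! * u !) (p′ ! * q′ !) {{(j + k) ℕₚ.!* u !≢0}} {{p′ ℕₚ.!* q′ !≢0}}
    j+[r∸u]≡k+r : ∀ {r} → u ≤ r → j + (r ∸ u) ≡ k + r
    j+[r∸u]≡k+r {r} u≤r = trans (ℕₚ.+-assoc k u (r ∸ u)) (cong (λ t → k + t) (ℕₚ.m+[n∸m]≡n u≤r))
    lhs : D * summand j * E ≡ D * ((a + a) ! * (b + b) !)
    lhs = begin
      D * (Cj * K) * ((j + k) ! * u ! * (p′ ! * q′ !))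
        ≡⟨ regroup D Cj K ((j + k) !) (u !) (p′ ! * q′ !) ⟩
      D * (K * ((Cj * ((j + k) ! * u !)) * (p′ ! * q′ !)))
        ≡⟨ cong (λ t → D * (K * (t * (p′ ! * q′ !)))) (C-factorials (j + k) u (double k u)) ⟩
      D * (K * ((j + j) ! * (p′ ! * q′ !)))
        ≡⟨ cong (D *_) (kernel-factorial j p′ q′ (j+[r∸u]≡k+r u≤p) (j+[r∸u]≡k+r u≤q)) ⟩
      D * ((a + a) ! * (b + b) !)
        ∎
      where
      Cj K : ℕ
      Cj = (j + j) C (j + k)
      K = kernel a b j
      regroup : ∀ d c x f v w → d * (c * x) * (f * v * w) ≡ d * (x * ((c * (f * v)) * w))
      regroup = solve-∀
      double : ∀ k u → ((k + u) + k) + u ≡ (k + u) + (k + u)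
      double = solve-∀
    rhs : Z * convolution-summand u * E ≡ D * ((a + a) ! * (b + b) !)
    rhs = begin
      Z * (Cp * Cb) * ((j + k) ! * u ! * (p′ ! * q′ !))
        ≡⟨ regroup Z Cp Cb ((j + k) !) (u !) (p′ !) (q′ !) ⟩
      Z * ((Cp * (u ! * p′ !)) * (Cb * ((j + k) ! * q′ !)))
        ≡⟨ cong₂ (λ s t → Z * (s * t)) (C-factorials u p′ (ℕₚ.m+[n∸m]≡n u≤p)) (C-factorials (j + k) q′ j+k+q′≡b+k) ⟩
      Z * (p ! * (b + k) !)
        ≡⟨ regroup′ ((a + a) !) ((b + b) !) ((a + k) !) (q !) (p !) ((b + k) !) ⟩
      D * ((a + a) ! * (b + b) !)
        ∎
      where
      Cp Cb : ℕ
      Cp = p C u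
      Cb = (b + k) C (j + k)
      regroup : ∀ z c d f v x y → z * (c * d) * (f * v * (x * y)) ≡ z * ((c * (v * x)) * (d * (f * y)))
      regroup = solve-∀
      regroup′ : ∀ A B F Q P G → A * B * F * Q * (P * G) ≡ ((F * P) * (G * Q)) * (A * B)
      regroup′ = solve-∀
      shift : ∀ k u t → ((k + u) + k) + t ≡ ((k + u) + t) + k
      shift = solve-∀
      j+k+q′≡b+k : (j + k) + q′ ≡ b + k
      j+k+q′≡b+k = trans (shift k u q′) (cong (λ t → t + k) (j+[r∸u]≡k+r u≤q))

  cleared-summand : ∀ u → u ≤ p → D * summand (k + u) ≡ Z * convolution-summand u
  cleared-summand u u≤p with u ℕₚ.≤? q
  ... | yes u≤q = cleared-summand-within u u≤p u≤q
  ... | no u≰q  = cleared-summand-beyond u (ℕₚ.≰⇒> u≰q)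

  cleared-lhs : D * ((a + b) ! * ((a + a) C (a + k)) * ((b + b) C (b + k))) ≡ (a + b) ! * ((a + a) ! * (b + b) !)
  cleared-lhs = begin
    D * ((a + b) ! * Ca * Cb)                                          ≡⟨ regroup ((a + k) !) (p !) ((b + k) !) (q !) ((a + b) !) Ca Cb ⟩
    (a + b) ! * ((Ca * ((a + k) ! * p !)) * (Cb * ((b + k) ! * q !))) ≡⟨ cong₂ (λ s t → (a + b) ! * (s * t)) (C-factorials (a + k) p (double k p))
                                                                                                          (C-factorials (b + k) q (double k q)) ⟩
    (a + b) ! * ((a + a) ! * (b + b) !)                               ∎
    where
    open ≡-Reasoning
    Ca Cb : ℕ
    Ca = (a + a) C (a + k)
    Cb = (b + b) C (b + k)
    regroup : ∀ F P G Q L x y → F * P * (G * Q) * (L * x * y) ≡ L * ((x * (F * P)) * (y * (G * Q)))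
    regroup = solve-∀
    double : ∀ k r → ((k + r) + k) + r ≡ (k + r) + (k + r)
    double = solve-∀

  cleared-rhs : D * ∑ (suc a) summand ≡ (a + b) ! * ((a + a) ! * (b + b) !)
  cleared-rhs = begin
    D * ∑ (suc a) summand
      ≡⟨ ℕ∑.∑-distribˡ (suc a) D summand ⟩
    ∑ (suc a) (λ j → D * summand j)
      ≡⟨ cong (λ n → ∑ n (λ j → D * summand j)) (ℕₚ.+-suc k p) ⟨
    ∑ (k + suc p) (λ j → D * summand j)
      ≡⟨ ℕ∑.∑-+ k (suc p) (λ j → D * summand j) ⟩
    ∑ k (λ j → D * summand j) + ∑ (suc p) (λ u → D * summand (k + u))
      ≡⟨ cong (_+ ∑ (suc p) (λ u → D * summand (k + u))) (ℕ∑.∑-zero k below-k) ⟩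
    ∑ (suc p) (λ u → D * summand (k + u))
      ≡⟨ ℕ∑.∑-cong (suc p) (λ u u<1+p → cleared-summand u (ℕₚ.≤-pred u<1+p)) ⟩
    ∑ (suc p) (λ u → Z * convolution-summand u)
      ≡⟨ ℕ∑.∑-distribˡ (suc p) Z convolution-summand ⟨
    Z * ∑ (suc p) convolution-summand
      ≡⟨ cong (Z *_) (ℕ∑.∑-cong (suc p) (λ u _ → cong (λ t → (p C u) * ((b + k) C t)) (swap k u))) ⟩
    Z * ∑ (suc p) (λ u → (p C u) * ((b + k) C ((k + k) + u)))
      ≡⟨ cong (Z *_) (vandermonde p (b + k) (k + k)) ⟩
    Z * ((p + (b + k)) C (p + (k + k)))
      ≡⟨ cong₂ (λ s t → Z * (s C t)) (total k p q) (top k p) ⟩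
    Z * ((a + b) C (a + k))
      ≡⟨ regroup ((a + a) !) ((b + b) !) ((a + k) !) (q !) ((a + b) C (a + k)) ⟩
    ((a + b) C (a + k)) * ((a + k) ! * q !) * ((a + a) ! * (b + b) !)
      ≡⟨ cong (_* ((a + a) ! * (b + b) !)) (C-factorials (a + k) q (total′ k p q)) ⟩
    (a + b) ! * ((a + a) ! * (b + b) !)
      ∎
    where
    open ≡-Reasoning
    below-k : ∀ j → j < k → D * summand j ≡ 0
    below-k j j<k = trans (cong (λ t → D * (t * kernel a b j)) (k>n⇒nCk≡0 (ℕₚ.+-monoʳ-< j j<k))) (ℕₚ.*-zeroʳ D)
    swap : ∀ k u → (k + u) + k ≡ (k + k) + u
    swap = solve-∀
    total : ∀ k p q → p + ((k + q) + k) ≡ (k + p) + (k + q)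
    total = solve-∀
    top : ∀ k p → p + (k + k) ≡ (k + p) + k
    top = solve-∀
    total′ : ∀ k p q → ((k + p) + k) + q ≡ (k + p) + (k + q)
    total′ = solve-∀
    regroup : ∀ A B F Q x → A * B * F * Q * x ≡ x * (F * Q) * (A * B)
    regroup = solve-∀

  central-identity-≤ : (a + b) ! * ((a + a) C (a + k)) * ((b + b) C (b + k)) ≡ ∑ (suc a) summand
  central-identity-≤ = ℕₚ.*-cancelˡ-≡ _ _ D (trans cleared-lhs (sym cleared-rhs))
    where instance _ = ℕₚ.m*n≢0 ((a + k) ! * p !) ((b + k) ! * q !) {{(a + k) ℕₚ.!* p !≢0}} {{(b + k) ℕₚ.!* q !≢0}}

central-identity : ∀ a b k → (a + b) ! * ((a + a) C (a + k)) * ((b + b) C (b + k))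
                             ≡ ∑ (suc a) (λ j → ((j + j) C (j + k)) * kernel a b j)
central-identity a b k with k ℕₚ.≤? a | k ℕₚ.≤? b
... | yes k≤a | yes k≤b = subst₂ (λ a b → (a + b) ! * ((a + a) C (a + k)) * ((b + b) C (b + k))
                                           ≡ ∑ (suc a) (λ j → ((j + j) C (j + k)) * kernel a b j))
                                 (ℕₚ.m+[n∸m]≡n k≤a) (ℕₚ.m+[n∸m]≡n k≤b) (CentralIdentity.central-identity-≤ k (a ∸ k) (b ∸ k))
... | no k≰a | _ = trans lhs-vanishes (sym (ℕ∑.∑-zero (suc a) term-vanishes))
  where
  lhs-vanishes : (a + b) ! * ((a + a) C (a + k)) * ((b + b) C (b + k)) ≡ 0
  lhs-vanishes rewrite k>n⇒nCk≡0 (ℕₚ.+-monoʳ-< a (ℕₚ.≰⇒> k≰a)) | ℕₚ.*-zeroʳ ((a + b) !) = refl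
  term-vanishes : ∀ j → j < suc a → ((j + j) C (j + k)) * kernel a b j ≡ 0
  term-vanishes j j<1+a rewrite k>n⇒nCk≡0 (ℕₚ.+-monoʳ-< j (ℕₚ.<-≤-trans j<1+a (ℕₚ.≰⇒> k≰a))) = refl
... | yes _ | no k≰b = trans lhs-vanishes (sym (ℕ∑.∑-zero (suc a) term-vanishes))
  where
  lhs-vanishes : (a + b) ! * ((a + a) C (a + k)) * ((b + b) C (b + k)) ≡ 0
  lhs-vanishes rewrite k>n⇒nCk≡0 (ℕₚ.+-monoʳ-< b (ℕₚ.≰⇒> k≰b)) = ℕₚ.*-zeroʳ ((a + b) ! * ((a + a) C (a + k)))
  term-vanishes : ∀ j → j < suc a → ((j + j) C (j + k)) * kernel a b j ≡ 0
  term-vanishes j _ with j ℕₚ.<? k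
  ... | yes j<k rewrite k>n⇒nCk≡0 (ℕₚ.+-monoʳ-< j j<k) = refl
  ... | no j≮k rewrite kernel-vanishes a b j (ℕₚ.<-≤-trans (ℕₚ.≰⇒> k≰b) (ℕₚ.≮⇒≥ j≮k)) = ℕₚ.*-zeroʳ ((j + j) C (j + k))

sumRange≡∑ : ∀ n f → sumRange n f ≡ ℤ∑.∑ n f
sumRange≡∑ zero    f = refl
sumRange≡∑ (suc n) f = cong (_+ℤ f n) (sumRange≡∑ n f)

sumSym≡∑ : ∀ R f → sumSym R f ≡ ℤ∑.∑ (suc (R + R)) (λ t → f (+ t - + R))
sumSym≡∑ R f = sumRange≡∑ (suc (R + R)) (λ t → f (+ t - + R))

sumSym-cong : ∀ R {f g} → (∀ k → f k ≡ g k) → sumSym R f ≡ sumSym R g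
sumSym-cong R {f} {g} eq = begin
  sumSym R f                                 ≡⟨ sumSym≡∑ R f ⟩
  ℤ∑.∑ (suc (R + R)) (λ t → f (+ t - + R))   ≡⟨ ℤ∑.∑-cong (suc (R + R)) (λ t _ → eq (+ t - + R)) ⟩
  ℤ∑.∑ (suc (R + R)) (λ t → g (+ t - + R))   ≡⟨ sumSym≡∑ R g ⟨
  sumSym R g                                 ∎
  where open ≡-Reasoning

sumSym-distribˡ : ∀ R x f → x *ℤ sumSym R f ≡ sumSym R (λ k → x *ℤ f k)
sumSym-distribˡ R x f = begin
  x *ℤ sumSym R f                                  ≡⟨ cong (x *ℤ_) (sumSym≡∑ R f) ⟩
  x *ℤ ℤ∑.∑ (suc (R + R)) (λ t → f (+ t - + R))    ≡⟨ ℤ∑.∑-distribˡ (suc (R + R)) x _ ⟩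
  ℤ∑.∑ (suc (R + R)) (λ t → x *ℤ f (+ t - + R))    ≡⟨ sumSym≡∑ R (λ k → x *ℤ f k) ⟨
  sumSym R (λ k → x *ℤ f k)                        ∎
  where open ≡-Reasoning

sumSym-comm : ∀ R n (h : ℤ → ℕ → ℤ) → sumSym R (λ k → ℤ∑.∑ n (h k)) ≡ ℤ∑.∑ n (λ j → sumSym R (λ k → h k j))
sumSym-comm R n h = begin
  sumSym R (λ k → ℤ∑.∑ n (h k))                                      ≡⟨ sumSym≡∑ R (λ k → ℤ∑.∑ n (h k)) ⟩
  ℤ∑.∑ (suc (R + R)) (λ t → ℤ∑.∑ n (h (+ t - + R)))                   ≡⟨ ℤ∑.∑-comm (suc (R + R)) n (λ t → h (+ t - + R)) ⟩
  ℤ∑.∑ n (λ j → ℤ∑.∑ (suc (R + R)) (λ t → h (+ t - + R) j))          ≡⟨ ℤ∑.∑-cong n (λ j _ → sumSym≡∑ R (λ k → h k j)) ⟨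
  ℤ∑.∑ n (λ j → sumSym R (λ k → h k j))                              ∎
  where open ≡-Reasoning

pos-∑ : ∀ n f → + ℕ∑.∑ n f ≡ ℤ∑.∑ n (λ i → + f i)
pos-∑ zero    f = refl
pos-∑ (suc n) f = trans (ℤₚ.pos-+ (ℕ∑.∑ n f) (f n)) (cong (_+ℤ + f n) (pos-∑ n f))

pos-*-assoc : ∀ x y z → + (x * y) *ℤ z ≡ + x *ℤ (+ y *ℤ z)
pos-*-assoc x y z = trans (cong (_*ℤ z) (ℤₚ.pos-* x y)) (ℤₚ.*-assoc (+ x) (+ y) z)

∑-multiple : ∀ n d f → (∀ j → j < n → ∃[ N ] (+ N *ℤ d ≡ f j)) → ∃[ N ] (+ N *ℤ d ≡ ℤ∑.∑ n f)
∑-multiple zero    d f multiples = 0 , ℤₚ.*-zeroˡ d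
∑-multiple (suc n) d f multiples with ∑-multiple n d f (λ j j<n → multiples j (ℕₚ.m<n⇒m<1+n j<n)) | multiples n ℕₚ.≤-refl
... | N , N*d≡∑ | M , M*d≡fn = N + M , (begin
  + (N + M) *ℤ d          ≡⟨ cong (_*ℤ d) (ℤₚ.pos-+ N M) ⟩
  (+ N +ℤ + M) *ℤ d       ≡⟨ ℤₚ.*-distribʳ-+ d (+ N) (+ M) ⟩
  + N *ℤ d +ℤ + M *ℤ d    ≡⟨ cong₂ _+ℤ_ N*d≡∑ M*d≡fn ⟩
  ℤ∑.∑ n f +ℤ f n         ∎)
  where open ≡-Reasoning

centralC : ℕ → ℤ → ℕ
centralC x k = binomℤ (x + x) (+ x +ℤ k)

centralC≡C∣k∣ : ∀ x k → centralC x k ≡ (x + x) C (x + ∣ k ∣)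
centralC≡C∣k∣ x (+ k)    = refl
centralC≡C∣k∣ x -[1+ k ] with suc k ℕₚ.≤? x
... | yes k<x = trans (cong (binomℤ (x + x)) (ℤₚ.⊖-≥ k<x)) (C-sym (x ∸ suc k) (x + suc k) complement)
  where
  open ≡-Reasoning
  complement : (x ∸ suc k) + (x + suc k) ≡ x + x
  complement = begin
    (x ∸ suc k) + (x + suc k) ≡⟨ cong (λ t → (x ∸ suc k) + t) (ℕₚ.+-comm x (suc k)) ⟩
    (x ∸ suc k) + (suc k + x) ≡⟨ ℕₚ.+-assoc (x ∸ suc k) (suc k) x ⟨
    ((x ∸ suc k) + suc k) + x ≡⟨ cong (_+ x) (ℕₚ.m∸n+n≡m k<x) ⟩
    x + x                     ∎
... | no k≮x = begin
  binomℤ (x + x) (x ⊖ suc k)        ≡⟨ cong (binomℤ (x + x)) (ℤₚ.⊖-< x<1+k) ⟩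
  binomℤ (x + x) (- + (suc k ∸ x))  ≡⟨ cong (λ t → binomℤ (x + x) (- + t)) (ℕₚ.+-∸-assoc 1 (ℕₚ.≤-pred x<1+k)) ⟩
  0                                 ≡⟨ k>n⇒nCk≡0 (ℕₚ.+-monoʳ-< x x<1+k) ⟨
  (x + x) C (x + suc k)             ∎
  where
  open ≡-Reasoning
  x<1+k = ℕₚ.≰⇒> k≮x

central-identity-centralC : ∀ a b k → (a + b) ! * centralC a k * centralC b k ≡ ℕ∑.∑ (suc a) (λ j → centralC j k * kernel a b j)
central-identity-centralC a b k = begin
  (a + b) ! * centralC a k * centralC b k
    ≡⟨ cong₂ (λ x y → (a + b) ! * x * y) (centralC≡C∣k∣ a k) (centralC≡C∣k∣ b k) ⟩
  (a + b) ! * ((a + a) C (a + ∣ k ∣)) * ((b + b) C (b + ∣ k ∣))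
    ≡⟨ central-identity a b ∣ k ∣ ⟩
  ℕ∑.∑ (suc a) (λ j → ((j + j) C (j + ∣ k ∣)) * kernel a b j)
    ≡⟨ ℕ∑.∑-cong (suc a) (λ j _ → cong (_* kernel a b j) (centralC≡C∣k∣ j k)) ⟨
  ℕ∑.∑ (suc a) (λ j → centralC j k * kernel a b j)
    ∎
  where open ≡-Reasoning

sign-suc : ∀ k → sign (k +ℤ + 1) ≡ - sign k
sign-suc (+ m)            = trans (cong (λ e → (- + 1) ^ e) (ℕₚ.+-comm m 1)) (ℤₚ.-1*i≡-i _)
sign-suc -[1+ zero ]      = refl
sign-suc -[1+ suc m ]     = trans (sym (ℤₚ.neg-involutive _)) (cong -_ (sym (ℤₚ.-1*i≡-i ((- + 1) ^ suc m))))

pascalℤ : ∀ n z → binomℤ (suc n) z ≡ binomℤ n (z - + 1) + binomℤ n z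
pascalℤ n (+ zero)  = refl
pascalℤ n (+ suc m) = sym (nCk+nC[k+1]≡[n+1]C[k+1] n m)
pascalℤ n -[1+ m ]  = refl

∑-alternating-telescope : ∀ (σ v : ℕ → ℤ) → (∀ t → σ (suc t) ≡ - σ t) → ∀ n →
                          ℤ∑.∑ n (λ t → σ t *ℤ (v t +ℤ v (suc t))) ≡ σ 0 *ℤ v 0 - σ n *ℤ v n
∑-alternating-telescope σ v alternates zero    = sym (ℤₚ.+-inverseʳ (σ 0 *ℤ v 0))
∑-alternating-telescope σ v alternates (suc n) = begin
  ℤ∑.∑ n (λ t → σ t *ℤ (v t +ℤ v (suc t))) +ℤ σ n *ℤ (v n +ℤ v (suc n))
    ≡⟨ cong (_+ℤ σ n *ℤ (v n +ℤ v (suc n))) (∑-alternating-telescope σ v alternates n) ⟩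
  σ 0 *ℤ v 0 - σ n *ℤ v n +ℤ σ n *ℤ (v n +ℤ v (suc n))
    ≡⟨ cancel (σ 0 *ℤ v 0) (σ n) (v n) (v (suc n)) ⟩
  σ 0 *ℤ v 0 - (- σ n) *ℤ v (suc n)
    ≡⟨ cong (λ x → σ 0 *ℤ v 0 - x *ℤ v (suc n)) (alternates n) ⟨
  σ 0 *ℤ v 0 - σ (suc n) *ℤ v (suc n)
    ∎
  where
  open ≡-Reasoning
  cancel : ∀ x s y z → x - s *ℤ y +ℤ s *ℤ (y +ℤ z) ≡ x - (- s) *ℤ z
  cancel = ℤ-Solver.solve-∀

-- Pascal's rule makes the sum telescope; both boundary terms vanish because x ≤ R.
alternating-centralC-vanishes : ∀ x R → 0 < x → x ≤ R → sumSym R (λ k → sign k *ℤ + centralC x k) ≡ + 0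
alternating-centralC-vanishes (suc a) R _ a<R = begin
  sumSym R (λ k → sign k *ℤ + centralC (suc a) k)
    ≡⟨ sumSym≡∑ R (λ k → sign k *ℤ + centralC (suc a) k) ⟩
  ℤ∑.∑ (suc (R + R)) (λ t → σ t *ℤ + centralC (suc a) (k t))
    ≡⟨ ℤ∑.∑-cong (suc (R + R)) (λ t _ → cong (σ t *ℤ_) (pascal-step t)) ⟩
  ℤ∑.∑ (suc (R + R)) (λ t → σ t *ℤ (v t +ℤ v (suc t)))
    ≡⟨ ∑-alternating-telescope σ v (λ t → trans (cong sign (shift (+ t) (+ R))) (sign-suc (k t))) (suc (R + R)) ⟩
  σ 0 *ℤ v 0 - σ (suc (R + R)) *ℤ v (suc (R + R))
    ≡⟨ cong₂ (λ x y → σ 0 *ℤ x - σ (suc (R + R)) *ℤ y) v-first v-last ⟩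
  σ 0 *ℤ + 0 - σ (suc (R + R)) *ℤ + 0
    ≡⟨ cong₂ _-_ (ℤₚ.*-zeroʳ (σ 0)) (ℤₚ.*-zeroʳ (σ (suc (R + R)))) ⟩
  + 0
    ∎
  where
  open ≡-Reasoning
  n : ℕ
  n = a + suc a
  k : ℕ → ℤ
  k t = + t - + R
  σ v : ℕ → ℤ
  σ t = sign (k t)
  v t = + binomℤ n (+ a +ℤ k t)
  shift : ∀ t r → (+ 1 +ℤ t) - r ≡ (t - r) +ℤ + 1
  shift = ℤ-Solver.solve-∀
  pascal-step : ∀ t → + centralC (suc a) (k t) ≡ v t +ℤ v (suc t)
  pascal-step t = begin
    + binomℤ (suc n) (+ suc a +ℤ k t)
      ≡⟨ cong +_ (pascalℤ n (+ suc a +ℤ k t)) ⟩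
    + (binomℤ n (+ suc a +ℤ k t - + 1) + binomℤ n (+ suc a +ℤ k t))
      ≡⟨ ℤₚ.pos-+ (binomℤ n (+ suc a +ℤ k t - + 1)) (binomℤ n (+ suc a +ℤ k t)) ⟩
    + binomℤ n (+ suc a +ℤ k t - + 1) +ℤ + binomℤ n (+ suc a +ℤ k t)
      ≡⟨ cong₂ (λ x y → + binomℤ n x +ℤ + binomℤ n y) (lower (+ a) (+ t) (+ R)) (upper (+ a) (+ t) (+ R)) ⟩
    v t +ℤ v (suc t)
      ∎
    where
    lower : ∀ x t r → (+ 1 +ℤ x) +ℤ (t - r) - + 1 ≡ x +ℤ (t - r)
    lower = ℤ-Solver.solve-∀
    upper : ∀ x t r → (+ 1 +ℤ x) +ℤ (t - r) ≡ x +ℤ ((+ 1 +ℤ t) - r)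
    upper = ℤ-Solver.solve-∀
  v-first : v 0 ≡ + 0
  v-first = cong (λ z → + binomℤ n z) (trans (cong (λ r → + a +ℤ (+ 0 - + r)) (sym (ℕₚ.m+[n∸m]≡n a<R))) (below (+ a) (+ (R ∸ suc a))))
    where
    below : ∀ x d → x +ℤ (+ 0 - ((+ 1 +ℤ x) +ℤ d)) ≡ - (+ 1 +ℤ d)
    below = ℤ-Solver.solve-∀
  v-last : v (suc (R + R)) ≡ + 0
  v-last = cong +_ (trans (cong (binomℤ n) (above (+ a) (+ R))) (k>n⇒nCk≡0 (ℕₚ.+-monoʳ-< a (s≤s a<R))))
    where
    above : ∀ x r → x +ℤ ((+ 1 +ℤ (r +ℤ r)) - r) ≡ x +ℤ (+ 1 +ℤ r)
    above = ℤ-Solver.solve-∀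

centralC-0-vanishes : ∀ k → k ≢ + 0 → centralC 0 k ≡ 0
centralC-0-vanishes (+ zero)  k≢0 = ⊥-elim (k≢0 refl)
centralC-0-vanishes (+ suc m) k≢0 = refl
centralC-0-vanishes -[1+ m ]  k≢0 = refl

alternating-centralC-0≡1 : ∀ R → sumSym R (λ k → sign k *ℤ + centralC 0 k) ≡ + 1
alternating-centralC-0≡1 R = begin
  sumSym R (λ k → sign k *ℤ + centralC 0 k)   ≡⟨ sumSym≡∑ R (λ k → sign k *ℤ + centralC 0 k) ⟩
  ℤ∑.∑ (suc (R + R)) f                        ≡⟨ ℤ∑.∑-single (suc (R + R)) R (s≤s (ℕₚ.m≤m+n R R)) off-centre ⟩
  f R                                         ≡⟨ cong (λ k → sign k *ℤ + centralC 0 k) (ℤₚ.+-inverseʳ (+ R)) ⟩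
  + 1                                         ∎
  where
  open ≡-Reasoning
  f : ℕ → ℤ
  f t = sign (+ t - + R) *ℤ + centralC 0 (+ t - + R)
  off-centre : ∀ t → t ≢ R → f t ≡ + 0
  off-centre t t≢R = trans (cong (λ c → sign (+ t - + R) *ℤ + c) (centralC-0-vanishes (+ t - + R) k≢0)) (ℤₚ.*-zeroʳ (sign (+ t - + R)))
    where
    k≢0 : + t - + R ≢ + 0
    k≢0 eq = t≢R (ℤₚ.+-injective (ℤₚ.i-j≡0⇒i≡j (+ t) (+ R) eq))

-- The entries are s 1, …, s m; the first factor (s 0 + s 1)! is n₁! for the theorem's s 0 = 0.
numerator : ℕ → (ℕ → ℕ) → ℕ
numerator m s = prodℕ (suc m) (λ i → (s (ℕ.pred i) + s i) !)

denominator : ℕ → (ℕ → ℕ) → ℕ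
denominator m s = prodℕ m (λ i → (s i + s i) !)

alternatingSum : ℕ → (ℕ → ℕ) → ℕ → ℤ
alternatingSum m s R = sumSym R (λ k → sign k *ℤ prodℤ m (λ i → + centralC (s i) k))

Integral : ℕ → (ℕ → ℕ) → ℕ → Set
Integral m s R = ∃[ N ] (+ N *ℤ + denominator m s ≡ + numerator m s *ℤ alternatingSum m s R)

prodℕ-cong : ∀ m {f g} → (∀ i → i ≤ m → f i ≡ g i) → prodℕ m f ≡ prodℕ m g
prodℕ-cong zero    eq = refl
prodℕ-cong (suc m) eq = cong₂ _*_ (prodℕ-cong m (λ i i≤m → eq i (ℕₚ.m≤n⇒m≤1+n i≤m))) (eq (suc m) ℕₚ.≤-refl)

prodℤ-cong : ∀ m {f g} → (∀ i → i ≤ m → f i ≡ g i) → prodℤ m f ≡ prodℤ m g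
prodℤ-cong zero    eq = refl
prodℤ-cong (suc m) eq = cong₂ _*ℤ_ (prodℤ-cong m (λ i i≤m → eq i (ℕₚ.m≤n⇒m≤1+n i≤m))) (eq (suc m) ℕₚ.≤-refl)

setLast : (ℕ → ℕ) → ℕ → ℕ → ℕ → ℕ
setLast s zero    j zero    = j
setLast s zero    j (suc i) = 0
setLast s (suc p) j zero    = s 0
setLast s (suc p) j (suc i) = setLast (λ i → s (suc i)) p j i

setLast-below : ∀ s p j i → i < p → setLast s p j i ≡ s i
setLast-below s (suc p) j zero    _         = refl
setLast-below s (suc p) j (suc i) (s≤s i<p) = setLast-below (λ i → s (suc i)) p j i i<p

setLast-at : ∀ s p j → setLast s p j p ≡ j
setLast-at s zero    j = refl
setLast-at s (suc p) j = setLast-at (λ i → s (suc i)) p j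

setLast-above : ∀ s p j i → p < i → setLast s p j i ≡ 0
setLast-above s zero    j (suc i) _         = refl
setLast-above s (suc p) j (suc i) (s≤s p<i) = setLast-above (λ i → s (suc i)) p j i p<i

alternatingSum-1 : ∀ s R → alternatingSum 1 s R ≡ sumSym R (λ k → sign k *ℤ + centralC (s 1) k)
alternatingSum-1 s R = sumSym-cong R (λ k → cong (sign k *ℤ_) (ℤₚ.*-identityˡ (+ centralC (s 1) k)))

integral-1 : ∀ s R → s 1 ≤ R → Integral 1 s R
integral-1 s R s₁≤R with s 1 ℕₚ.≟ 0
... | yes s₁≡0 = numerator 1 s , (begin
  + numerator 1 s *ℤ + (1 * (s 1 + s 1) !) ≡⟨ cong (λ x → + numerator 1 s *ℤ + (1 * (x + x) !)) s₁≡0 ⟩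
  + numerator 1 s *ℤ + 1                   ≡⟨ cong (+ numerator 1 s *ℤ_) (alternating-centralC-0≡1 R) ⟨
  + numerator 1 s *ℤ A 0                   ≡⟨ cong (λ x → + numerator 1 s *ℤ A x) s₁≡0 ⟨
  + numerator 1 s *ℤ A (s 1)               ≡⟨ cong (+ numerator 1 s *ℤ_) (alternatingSum-1 s R) ⟨
  + numerator 1 s *ℤ alternatingSum 1 s R  ∎)
  where
  open ≡-Reasoning
  A : ℕ → ℤ
  A x = sumSym R (λ k → sign k *ℤ + centralC x k)
... | no s₁≢0 = 0 , sym (begin
  + numerator 1 s *ℤ alternatingSum 1 s R
    ≡⟨ cong (+ numerator 1 s *ℤ_) (alternatingSum-1 s R) ⟩
  + numerator 1 s *ℤ sumSym R (λ k → sign k *ℤ + centralC (s 1) k)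
    ≡⟨ cong (+ numerator 1 s *ℤ_) (alternating-centralC-vanishes (s 1) R (ℕₚ.n≢0⇒n>0 s₁≢0) s₁≤R) ⟩
  + numerator 1 s *ℤ + 0
    ≡⟨ ℤₚ.*-zeroʳ (+ numerator 1 s) ⟩
  + 0
    ∎)
  where open ≡-Reasoning

-- The last two of the entries s 1, …, s (2 + m) are a and b, preceded by c; s[ j ] replaces
-- them by the single entry j.
module MergeLast (m : ℕ) (s : ℕ → ℕ) (R : ℕ) where

  c a b : ℕ
  c = s m
  a = s (suc m)
  b = s (suc (suc m))

  s[_] : ℕ → ℕ → ℕ
  s[ j ] = setLast s (suc m) j

  s[j]-below : ∀ j i → i ≤ m → s[ j ] i ≡ s i
  s[j]-below j i i≤m = setLast-below s (suc m) j i (s≤s i≤m)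

  numerator-prefix : ℕ
  numerator-prefix = prodℕ m (λ i → (s (ℕ.pred i) + s i) !)

  centralC-prefix : ℤ → ℤ
  centralC-prefix k = prodℤ m (λ i → + centralC (s i) k)

  numerator-s[j] : ∀ j → numerator (suc m) s[ j ] ≡ numerator-prefix * ((c + j) ! * j !)
  numerator-s[j] j = begin
    prodℕ m (λ i → (s[ j ] (ℕ.pred i) + s[ j ] i) !) * (s[ j ] m + s[ j ] (suc m)) ! * (s[ j ] (suc m) + s[ j ] (suc (suc m))) !
      ≡⟨ cong₂ (λ x y → x * y * (s[ j ] (suc m) + s[ j ] (suc (suc m))) !)
               prefix-eq (cong₂ (λ x y → (x + y) !) (s[j]-below j m ℕₚ.≤-refl) (setLast-at s (suc m) j)) ⟩
    numerator-prefix * (c + j) ! * (s[ j ] (suc m) + s[ j ] (suc (suc m))) !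
      ≡⟨ cong (λ x → numerator-prefix * (c + j) ! * x !)
              (cong₂ _+_ (setLast-at s (suc m) j) (setLast-above s (suc m) j (suc (suc m)) ℕₚ.≤-refl)) ⟩
    numerator-prefix * (c + j) ! * (j + 0) !
      ≡⟨ cong (λ x → numerator-prefix * (c + j) ! * x !) (ℕₚ.+-identityʳ j) ⟩
    numerator-prefix * (c + j) ! * j !
      ≡⟨ ℕₚ.*-assoc numerator-prefix ((c + j) !) (j !) ⟩
    numerator-prefix * ((c + j) ! * j !)
      ∎
    where
    open ≡-Reasoning
    prefix-eq : prodℕ m (λ i → (s[ j ] (ℕ.pred i) + s[ j ] i) !) ≡ numerator-prefix
    prefix-eq = prodℕ-cong m (λ i i≤m → cong₂ (λ x y → (x + y) !) (s[j]-below j (ℕ.pred i) (ℕₚ.≤-trans ℕₚ.pred[n]≤n i≤m)) (s[j]-below j i i≤m))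

  denominator-s[j] : ∀ j → denominator (suc m) s[ j ] ≡ denominator m s * (j + j) !
  denominator-s[j] j = cong₂ _*_ (prodℕ-cong m (λ i i≤m → cong (λ x → (x + x) !) (s[j]-below j i i≤m)))
                                 (cong (λ x → (x + x) !) (setLast-at s (suc m) j))

  alternatingSum-s[j] : ∀ j → alternatingSum (suc m) s[ j ] R ≡ sumSym R (λ k → sign k *ℤ (centralC-prefix k *ℤ + centralC j k))
  alternatingSum-s[j] j = sumSym-cong R (λ k → cong (sign k *ℤ_) (cong₂ _*ℤ_
    (prodℤ-cong m (λ i i≤m → cong (λ x → + centralC x k) (s[j]-below j i i≤m)))
    (cong (λ x → + centralC x k) (setLast-at s (suc m) j))))

  numerator-factor : ℕ
  numerator-factor = numerator-prefix * ((c + a) ! * b !)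

  numerator-split : s (3 + m) ≡ 0 → numerator (2 + m) s ≡ numerator-factor * (a + b) !
  numerator-split end≡0 = begin
    numerator-prefix * (c + a) ! * (a + b) ! * (b + s (3 + m)) !
      ≡⟨ cong (λ x → numerator-prefix * (c + a) ! * (a + b) ! * x !) (trans (cong (λ x → b + x) end≡0) (ℕₚ.+-identityʳ b)) ⟩
    numerator-prefix * (c + a) ! * (a + b) ! * b !
      ≡⟨ regroup numerator-prefix ((c + a) !) ((a + b) !) (b !) ⟩
    numerator-prefix * ((c + a) ! * b !) * (a + b) !
      ∎
    where
    open ≡-Reasoning
    regroup : ∀ w x y z → w * x * y * z ≡ w * (x * z) * y
    regroup = solve-∀

  alternatingSum-expand : + ((a + b) !) *ℤ alternatingSum (2 + m) s R
                          ≡ ℤ∑.∑ (suc a) (λ j → + kernel a b j *ℤ alternatingSum (suc m) s[ j ] R)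
  alternatingSum-expand = begin
    + ((a + b) !) *ℤ sumSym R (λ k → sign k *ℤ ((centralC-prefix k *ℤ + centralC a k) *ℤ + centralC b k))
      ≡⟨ sumSym-distribˡ R (+ ((a + b) !)) (λ k → sign k *ℤ ((centralC-prefix k *ℤ + centralC a k) *ℤ + centralC b k)) ⟩
    sumSym R (λ k → + ((a + b) !) *ℤ (sign k *ℤ ((centralC-prefix k *ℤ + centralC a k) *ℤ + centralC b k)))
      ≡⟨ sumSym-cong R expand-k ⟩
    sumSym R (λ k → ℤ∑.∑ (suc a) (λ j → + kernel a b j *ℤ (sign k *ℤ (centralC-prefix k *ℤ + centralC j k))))
      ≡⟨ sumSym-comm R (suc a) (λ k j → + kernel a b j *ℤ (sign k *ℤ (centralC-prefix k *ℤ + centralC j k))) ⟩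
    ℤ∑.∑ (suc a) (λ j → sumSym R (λ k → + kernel a b j *ℤ (sign k *ℤ (centralC-prefix k *ℤ + centralC j k))))
      ≡⟨ ℤ∑.∑-cong (suc a) (λ j _ → trans (sym (sumSym-distribˡ R (+ kernel a b j) (λ k → sign k *ℤ (centralC-prefix k *ℤ + centralC j k))))
                                         (cong (+ kernel a b j *ℤ_) (sym (alternatingSum-s[j] j)))) ⟩
    ℤ∑.∑ (suc a) (λ j → + kernel a b j *ℤ alternatingSum (suc m) s[ j ] R)
      ∎
    where
    open ≡-Reasoning
    expand-k : ∀ k → + ((a + b) !) *ℤ (sign k *ℤ ((centralC-prefix k *ℤ + centralC a k) *ℤ + centralC b k))
                     ≡ ℤ∑.∑ (suc a) (λ j → + kernel a b j *ℤ (sign k *ℤ (centralC-prefix k *ℤ + centralC j k)))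
    expand-k k = begin
      + L *ℤ (σ *ℤ ((p *ℤ + Ca) *ℤ + Cb))
        ≡⟨ regroup (+ L) σ p (+ Ca) (+ Cb) ⟩
      (σ *ℤ p) *ℤ (+ L *ℤ + Ca *ℤ + Cb)
        ≡⟨ cong ((σ *ℤ p) *ℤ_) (sym (trans (ℤₚ.pos-* (L * Ca) Cb) (cong (_*ℤ + Cb) (ℤₚ.pos-* L Ca)))) ⟩
      (σ *ℤ p) *ℤ + (L * Ca * Cb)
        ≡⟨ cong (λ x → (σ *ℤ p) *ℤ + x) (central-identity-centralC a b k) ⟩
      (σ *ℤ p) *ℤ + ℕ∑.∑ (suc a) (λ j → centralC j k * kernel a b j)
        ≡⟨ cong ((σ *ℤ p) *ℤ_) (pos-∑ (suc a) _) ⟩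
      (σ *ℤ p) *ℤ ℤ∑.∑ (suc a) (λ j → + (centralC j k * kernel a b j))
        ≡⟨ ℤ∑.∑-distribˡ (suc a) (σ *ℤ p) _ ⟩
      ℤ∑.∑ (suc a) (λ j → (σ *ℤ p) *ℤ + (centralC j k * kernel a b j))
        ≡⟨ ℤ∑.∑-cong (suc a) (λ j _ → trans (cong ((σ *ℤ p) *ℤ_) (ℤₚ.pos-* (centralC j k) (kernel a b j)))
                                           (regroup′ σ p (+ centralC j k) (+ kernel a b j))) ⟩
      ℤ∑.∑ (suc a) (λ j → + kernel a b j *ℤ (σ *ℤ (p *ℤ + centralC j k)))
        ∎
      where
      L Ca Cb : ℕ
      L = (a + b) !
      Ca = centralC a k
      Cb = centralC b k
      σ p : ℤ
      σ = sign k
      p = centralC-prefix k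
      regroup : ∀ l σ p x y → l *ℤ (σ *ℤ ((p *ℤ x) *ℤ y)) ≡ (σ *ℤ p) *ℤ (l *ℤ x *ℤ y)
      regroup = ℤ-Solver.solve-∀
      regroup′ : ∀ σ p x y → (σ *ℤ p) *ℤ (x *ℤ y) ≡ y *ℤ (σ *ℤ (p *ℤ x))
      regroup′ = ℤ-Solver.solve-∀

  merged-term : ℕ → ℤ
  merged-term j = + (numerator-factor * kernel a b j) *ℤ alternatingSum (suc m) s[ j ] R

  numerator-alternatingSum-expand : s (3 + m) ≡ 0 →
                                    + numerator (2 + m) s *ℤ alternatingSum (2 + m) s R ≡ ℤ∑.∑ (suc a) merged-term
  numerator-alternatingSum-expand end≡0 = begin
    + numerator (2 + m) s *ℤ T                      ≡⟨ cong (λ x → + x *ℤ T) (numerator-split end≡0) ⟩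
    + (numerator-factor * (a + b) !) *ℤ T           ≡⟨ pos-*-assoc numerator-factor ((a + b) !) T ⟩
    + numerator-factor *ℤ (+ ((a + b) !) *ℤ T)      ≡⟨ cong (+ numerator-factor *ℤ_) alternatingSum-expand ⟩
    + numerator-factor *ℤ ℤ∑.∑ (suc a) (λ j → + kernel a b j *ℤ alternatingSum (suc m) s[ j ] R)
      ≡⟨ ℤ∑.∑-distribˡ (suc a) (+ numerator-factor) _ ⟩
    ℤ∑.∑ (suc a) (λ j → + numerator-factor *ℤ (+ kernel a b j *ℤ alternatingSum (suc m) s[ j ] R))
      ≡⟨ ℤ∑.∑-cong (suc a) (λ j _ → sym (pos-*-assoc numerator-factor (kernel a b j) (alternatingSum (suc m) s[ j ] R))) ⟩
    ℤ∑.∑ (suc a) merged-term                        ∎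
    where
    open ≡-Reasoning
    T : ℤ
    T = alternatingSum (2 + m) s R

  merged-binomials : ℕ → ℕ
  merged-binomials j = ((c + a) C (a ∸ j)) * (b C j)

  cleared-kernel : ℕ → ℕ
  cleared-kernel j = kernel a b j * ((a ∸ j) ! * (b ∸ j) !)

  numerator-regroup : ∀ j → j ≤ a → j ≤ b →
                      numerator-factor * kernel a b j ≡ merged-binomials j * cleared-kernel j * numerator (suc m) s[ j ]
  numerator-regroup j j≤a j≤b = begin
    numerator-prefix * ((c + a) ! * b !) * kernel a b j
      ≡⟨ cong (λ x → numerator-prefix * x * kernel a b j) (factorials-via-binomials c a b j j≤a j≤b) ⟩
    numerator-prefix * (merged-binomials j * (((a ∸ j) ! * (b ∸ j) !) * ((c + j) ! * j !))) * kernel a b j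
      ≡⟨ regroup numerator-prefix (merged-binomials j) ((a ∸ j) ! * (b ∸ j) !) ((c + j) ! * j !) (kernel a b j) ⟩
    merged-binomials j * cleared-kernel j * (numerator-prefix * ((c + j) ! * j !))
      ≡⟨ cong (merged-binomials j * cleared-kernel j *_) (numerator-s[j] j) ⟨
    merged-binomials j * cleared-kernel j * numerator (suc m) s[ j ]
      ∎
    where
    open ≡-Reasoning
    regroup : ∀ w x f t k → w * (x * (f * t)) * k ≡ x * (k * f) * (w * t)
    regroup = solve-∀

  denominator-regroup : ∀ j N → j ≤ a → j ≤ b →
                        merged-binomials j * cleared-kernel j * (N * denominator (suc m) s[ j ]) ≡ merged-binomials j * N * denominator (2 + m) s
  denominator-regroup j N j≤a j≤b = begin
    B * (K * F) * (N * denominator (suc m) s[ j ])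
      ≡⟨ cong (λ x → B * (K * F) * (N * x)) (denominator-s[j] j) ⟩
    B * (K * F) * (N * (denominator m s * (j + j) !))
      ≡⟨ regroup B K F N (denominator m s) ((j + j) !) ⟩
    B * N * (denominator m s * (K * ((j + j) ! * F)))
      ≡⟨ cong (λ x → B * N * (denominator m s * x)) (kernel-factorial j (a ∸ j) (b ∸ j) (ℕₚ.m+[n∸m]≡n j≤a) (ℕₚ.m+[n∸m]≡n j≤b)) ⟩
    B * N * (denominator m s * ((a + a) ! * (b + b) !))
      ≡⟨ cong (B * N *_) (ℕₚ.*-assoc (denominator m s) ((a + a) !) ((b + b) !)) ⟨
    B * N * denominator (2 + m) s
      ∎
    where
    open ≡-Reasoning
    B K F : ℕ
    B = merged-binomials j
    K = kernel a b j
    F = (a ∸ j) ! * (b ∸ j) !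
    regroup : ∀ x k f n d t → x * (k * f) * (n * (d * t)) ≡ x * n * (d * (k * (t * f)))
    regroup = solve-∀

  merged-term-multiple : ∀ j → j ≤ a → Integral (suc m) s[ j ] R → ∃[ N ] (+ N *ℤ + denominator (2 + m) s ≡ merged-term j)
  merged-term-multiple j j≤a (N , N-eq) with j ℕₚ.≤? b
  ... | no j≰b = 0 , sym (begin
    + (numerator-factor * kernel a b j) *ℤ T ≡⟨ cong (λ x → + (numerator-factor * x) *ℤ T) (kernel-vanishes a b j (ℕₚ.≰⇒> j≰b)) ⟩
    + (numerator-factor * 0) *ℤ T            ≡⟨ cong (λ x → + x *ℤ T) (ℕₚ.*-zeroʳ numerator-factor) ⟩
    + 0 *ℤ T                                 ≡⟨ ℤₚ.*-zeroˡ T ⟩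
    + 0                                      ∎)
    where
    open ≡-Reasoning
    T : ℤ
    T = alternatingSum (suc m) s[ j ] R
  ... | yes j≤b = B * N , sym (begin
    + (numerator-factor * kernel a b j) *ℤ T   ≡⟨ cong (λ x → + x *ℤ T) (numerator-regroup j j≤a j≤b) ⟩
    + (B * G * numerator (suc m) s[ j ]) *ℤ T  ≡⟨ pos-*-assoc (B * G) (numerator (suc m) s[ j ]) T ⟩
    + (B * G) *ℤ (+ numerator (suc m) s[ j ] *ℤ T) ≡⟨ cong (+ (B * G) *ℤ_) N-eq ⟨
    + (B * G) *ℤ (+ N *ℤ + D)                  ≡⟨ trans (ℤₚ.pos-* (B * G) (N * D)) (cong (+ (B * G) *ℤ_) (ℤₚ.pos-* N D)) ⟨
    + (B * G * (N * D))                        ≡⟨ cong +_ (denominator-regroup j N j≤a j≤b) ⟩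
    + (B * N * denominator (2 + m) s)          ≡⟨ ℤₚ.pos-* (B * N) (denominator (2 + m) s) ⟩
    + (B * N) *ℤ + denominator (2 + m) s       ∎)
    where
    open ≡-Reasoning
    B G D : ℕ
    B = merged-binomials j
    G = cleared-kernel j
    D = denominator (suc m) s[ j ]
    T : ℤ
    T = alternatingSum (suc m) s[ j ] R

  integral-merge : s (3 + m) ≡ 0 → (∀ j → j ≤ a → Integral (suc m) s[ j ] R) → Integral (2 + m) s R
  integral-merge end≡0 integral-s[j] =
    map₂ (λ N-eq → trans N-eq (sym (numerator-alternatingSum-expand end≡0)))
         (∑-multiple (suc a) (+ denominator (2 + m) s) merged-term
                     (λ j j<1+a → merged-term-multiple j (ℕₚ.≤-pred j<1+a) (integral-s[j] j (ℕₚ.≤-pred j<1+a))))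

integral : ∀ m s R → s (2 + m) ≡ 0 → s 1 ≤ R → Integral (suc m) s R
integral zero    s R _     s₁≤R = integral-1 s R s₁≤R
integral (suc m) s R end≡0 s₁≤R = MergeLast.integral-merge m s R end≡0 λ j j≤a →
  integral m (setLast s (suc m) j) R (setLast-above s (suc m) j (2 + m) ℕₚ.≤-refl) (first≤R m j j≤a)
  where
  first≤R : ∀ m j → j ≤ s (suc m) → setLast s (suc m) j 1 ≤ R
  first≤R zero    j j≤s₁ = ℕₚ.≤-trans j≤s₁ s₁≤R
  first≤R (suc m) j _    = s₁≤R

nth-beyond : ∀ {m} (n : Fin m → ℕ) → nth n (suc m) ≡ 0
nth-beyond {m} n with m ℕ.<? m
... | yes m<m = ⊥-elim (ℕₚ.<-irrefl refl m<m)
... | no _    = refl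

prodℕ-front : ∀ m f → prodℕ (suc m) f ≡ f 1 * prodℕ m (λ i → f (suc i))
prodℕ-front zero    f = ℕₚ.*-comm 1 (f 1)
prodℕ-front (suc m) f = trans (cong (_* f (2 + m)) (prodℕ-front m f)) (ℕₚ.*-assoc (f 1) _ _)

theorem4p8 : (m : ℕ) → 1 ≤ m → (n : Fin m → ℕ) → (∀ i → 1 ≤ n i) →
    ∃[ N ] ((+ N) *ℤ (+ prodℕ m (λ i → (nth n i + nth n i) !))
      ≡ (+ ((nth n 1) ! * prodℕ m (λ i → (nth n i + nth n (1 + i)) !)))
        *ℤ sumSym (nth n 1) (λ k → sign k *ℤ prodℤ m (λ i → + binomℤ (nth n i + nth n i) ((+ nth n i) +ℤ k))))
theorem4p8 (suc m) _ n _ =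
  map₂ (λ N-eq → trans N-eq (cong (λ w → + w *ℤ alternatingSum (suc m) (nth n) (nth n 1)) (prodℕ-front (suc m) _)))
       (integral m (nth n) (nth n 1) (nth-beyond n) ℕₚ.≤-refl)
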